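{- Let $T$ be a string, $\phi(i,j,w)$ an edit operation, $L=T[1..i-1]$, $R=T[j+1..|T|]$ and $T'=LwR$, with $|L|\ge|R|$, $|w|\le |L|/2$, and such that the longest border of $Lw$ is longer than $|w|$. Suppose $T'$ has a border longer than $R$, and let $b^\star$ be the border of $Lw$ such that $b^\star R$ is the longest border of $T'$. Partition the set of borders of $Lw$ into groups $G_1,\dots,G_m$ such that all borders in a group have the same smallest period and $p_k$ (the period of borders in $G_k$) satisfies $p_k>p_{k+1}$; let $k^\star$ be the index with $b^\star\in G_{k^\star}$. For each $k$, let $\alpha_k$ be the exponent of the longest prefix of $T'$ with period $p_k$, and let $r_k = \mathit{lce}_{T'}(|T'|-|R|-p_k+1,\ |T'|-|R|+1)$. If $b^\star$ is periodic and $p_{k^\star} \neq \mathsf{per}(b^\star R)$, then $|b^\star| = \alpha_{k^\star}p_{k^\star} - r_{k^\star}$.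
   Context: A border of a non-empty string $S$ is a string that is both a proper prefix and a proper suffix of $S$. If $S$ has a border $b$, $|S|-|b|$ is a period of $S$; $\mathsf{per}(S)$ is the smallest period. The exponent of $S$ is $|S|/\mathsf{per}(S)$. $S$ is periodic if $\mathsf{per}(S)\le |S|/2$. For a string $S$ and positions $a,b$, $\mathit{lce}_S(a,b)$ is the length of the longest common prefix of $S[a..|S|]$ and $S[b..|S|]$. The edit $\phi(i,j,w)$ with $1\le j\le |T|$, $1\le i\le j+1$ produces $T'=T[1..i-1]\,w\,T[j+1..|T|]$. -}

module Defs where

open import Data.Nat using (ℕ; zero; suc; _+_; _*_; _∸_; _≤_; _<_)
open import Data.List using (List; []; _∷_; length; take; drop; _++_)
open import Data.Product using (Σ; _×_)
open import Relation.Binary.PropositionalEquality using (_≡_)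
open import Relation.Nullary using (¬_)

-- Strings over an alphabet A are lists; positions in the paper are 1-based,
-- here prefixes/suffixes are expressed via take / drop.

module _ {A : Set} where

  Border : List A → List A → Set
  Border b S = (length b < length S)
             × (b ≡ take (length b) S)
             × (b ≡ drop (length S ∸ length b) S)

  HasPeriod : List A → ℕ → Set
  HasPeriod S p = Σ (List A) (λ b → Border b S × (p + length b ≡ length S))

  IsPer : List A → ℕ → Set
  IsPer S p = HasPeriod S p × (∀ q → HasPeriod S q → p ≤ q)

  LongestBorder : List A → List A → Set
  LongestBorder b S = Border b S × (∀ c → Border c S → length c ≤ length b)

  LongestPrefixWithPeriod : List A → ℕ → ℕ → Set
  LongestPrefixWithPeriod S p n =
    (n ≤ length S) × HasPeriod (take n S) p
    × (∀ m → m ≤ length S → HasPeriod (take m S) p → m ≤ n)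

  data LCP : List A → List A → ℕ → Set where
    lcp-[]ˡ : ∀ {ys} → LCP [] ys 0
    lcp-[]ʳ : ∀ {x xs} → LCP (x ∷ xs) [] 0
    lcp-≢   : ∀ {x y xs ys} → ¬ (x ≡ y) → LCP (x ∷ xs) (y ∷ ys) 0
    lcp-≡   : ∀ {x xs ys n} → LCP xs ys n → LCP (x ∷ xs) (x ∷ ys) (suc n)

  -- lce_S(a,b) = r with 1-based positions a, b:
  -- the longest common prefix of S[a..|S|] and S[b..|S|].
  LCE : List A → ℕ → ℕ → ℕ → Set
  LCE S a b r = LCP (drop (a ∸ 1) S) (drop (b ∸ 1) S) r

-- Since b⋆R is a prefix of T′, the run of period p at the start of T′ covers b⋆ and then
-- lasts exactly as long as R repeats the letters p positions earlier, i.e. r more letters,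
-- provided the run ends inside b⋆R. It does: were p a period of all of b⋆R, then
-- per(b⋆R) = q < p, and since q + p ≤ 2p ≤ |b⋆| the weak periodicity lemma turns the periods
-- q and p of b⋆R into the period p − q < p of b⋆, contradicting per(b⋆) = p.

module Submission where

open import Data.Nat using (ℕ; zero; suc; _+_; _*_; _∸_; _≤_; _<_; z≤n; s≤s; z<s; _<?_)
open import Data.Nat.Properties
open import Algebra.Properties.CommutativeSemigroup +-commutativeSemigroup using (xy∙z≈xz∙y)
open import Data.List using (List; []; _∷_; length; take; drop; _++_; head)
open import Data.List.Properties using (length-take; length-drop; length-++; length-++-≤ˡ; drop-drop)
open import Data.Maybe using (Maybe)
open import Data.Maybe.Properties using (just-injective)
open import Data.Product using (Σ; _×_; _,_; proj₁)
open import Function using (_∘_)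
open import Relation.Binary.PropositionalEquality
open import Relation.Nullary using (¬_; yes; no; contradiction)
open import Defs

module _ {A : Set} where

  infixl 9 _!_

  _!_ : List A → ℕ → Maybe A
  xs ! i = head (drop i xs)

  !-drop : ∀ k (xs : List A) i → drop k xs ! i ≡ xs ! (k + i)
  !-drop k xs i = cong head (drop-drop k i xs)

  AgreeBelow : ℕ → List A → List A → Set
  AgreeBelow n xs ys = ∀ i → i < n → xs ! i ≡ ys ! i

  agree-sym : ∀ {n} {xs ys : List A} → AgreeBelow n xs ys → AgreeBelow n ys xs
  agree-sym xs≈ys i i<n = sym (xs≈ys i i<n)

  agree-≤ : ∀ {m n} {xs ys : List A} → m ≤ n → AgreeBelow n xs ys → AgreeBelow m xs ys
  agree-≤ m≤n xs≈ys i i<m = xs≈ys i (<-≤-trans i<m m≤n)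

  take-agree : ∀ k (xs : List A) → AgreeBelow k (take k xs) xs
  take-agree (suc k) []       zero    _         = refl
  take-agree (suc k) []       (suc i) _         = refl
  take-agree (suc k) (x ∷ xs) zero    _         = refl
  take-agree (suc k) (x ∷ xs) (suc i) (s≤s i<k) = take-agree k xs i i<k

  ++-agree : ∀ (xs ys : List A) → AgreeBelow (length xs) (xs ++ ys) xs
  ++-agree (x ∷ xs) ys zero    _         = refl
  ++-agree (x ∷ xs) ys (suc i) (s≤s i<n) = ++-agree xs ys i i<n

  agree⇒≡ : ∀ {xs ys : List A} → length xs ≡ length ys →
            AgreeBelow (length xs) xs ys → xs ≡ ys
  agree⇒≡ {[]}     {[]}     _   _     = refl
  agree⇒≡ {x ∷ xs} {y ∷ ys} |xs|≡|ys| xs≈ys =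
    cong₂ _∷_ (just-injective (xs≈ys 0 z<s))
              (agree⇒≡ (suc-injective |xs|≡|ys|) (λ i → xs≈ys (suc i) ∘ s≤s))

  LCP-agree : ∀ {xs ys : List A} {r} → LCP xs ys r → AgreeBelow r xs ys
  LCP-agree (lcp-≡ lcp) zero    _         = refl
  LCP-agree (lcp-≡ lcp) (suc i) (s≤s i<r) = LCP-agree lcp i i<r

  LCP-≤-length : ∀ {xs ys : List A} {r} → LCP xs ys r → r ≤ length ys
  LCP-≤-length lcp-[]ˡ       = z≤n
  LCP-≤-length lcp-[]ʳ       = z≤n
  LCP-≤-length (lcp-≢ _)     = z≤n
  LCP-≤-length (lcp-≡ lcp)   = s≤s (LCP-≤-length lcp)

  LCP-mismatch : ∀ {xs ys : List A} {r} → LCP xs ys r → r < length ys → xs ! r ≢ ys ! r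
  LCP-mismatch (lcp-[]ˡ {_ ∷ _}) _         ()
  LCP-mismatch (lcp-≢ x≢y)       _         = x≢y ∘ just-injective
  LCP-mismatch (lcp-≡ lcp)       (s≤s r<n) = LCP-mismatch lcp r<n

  length-take-≤ : ∀ {n} (T : List A) → n ≤ length T → length (take n T) ≡ n
  length-take-≤ {n} T n≤|T| = trans (length-take n T) (m≤n⇒m⊓n≡m n≤|T|)

  PrefixPeriod : List A → ℕ → ℕ → Set
  PrefixPeriod S n p = ∀ i → i + p < n → S ! i ≡ S ! (i + p)

  PrefixPeriod-≤ : ∀ {S : List A} {m n p} → m ≤ n → PrefixPeriod S n p → PrefixPeriod S m p
  PrefixPeriod-≤ m≤n per i i+p<m = per i (<-≤-trans i+p<m m≤n)

  PrefixPeriod-agree : ∀ {S T : List A} {n p} → AgreeBelow n S T →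
                       PrefixPeriod S n p → PrefixPeriod T n p
  PrefixPeriod-agree {p = p} S≈T per i i+p<n =
    trans (sym (S≈T i (≤-<-trans (m≤m+n i p) i+p<n))) (trans (per i i+p<n) (S≈T (i + p) i+p<n))

  HasPeriod⇒0<p : ∀ {U : List A} {p} → HasPeriod U p → 0 < p
  HasPeriod⇒0<p {p = zero}  (_ , (|b|<|U| , _) , |b|≡|U|) = contradiction |b|≡|U| (<⇒≢ |b|<|U|)
  HasPeriod⇒0<p {p = suc _} _                          = z<s

  HasPeriod⇒≤length : ∀ {U : List A} {p} → HasPeriod U p → p ≤ length U
  HasPeriod⇒≤length {p = p} (b , _ , p+|b|≡|U|) = subst (p ≤_) p+|b|≡|U| (m≤m+n p (length b))

  HasPeriod⇒PrefixPeriod : ∀ {U : List A} {p} → HasPeriod U p → PrefixPeriod U (length U) p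
  HasPeriod⇒PrefixPeriod {U} {p} (b , (_ , b-prefix , b-suffix) , p+|b|≡|U|) i i+p<|U| = begin
    U ! i                                 ≡⟨ sym (take-agree (length b) U i i<|b|) ⟩
    take (length b) U ! i                 ≡⟨ cong (_! i) (sym b-prefix) ⟩
    b ! i                                 ≡⟨ cong (_! i) b-suffix ⟩
    drop (length U ∸ length b) U ! i      ≡⟨ !-drop (length U ∸ length b) U i ⟩
    U ! (length U ∸ length b + i)         ≡⟨ cong (λ k → U ! (k + i)) |U|∸|b|≡p ⟩
    U ! (p + i)                           ≡⟨ cong (U !_) (+-comm p i) ⟩
    U ! (i + p)                           ∎
    where
      open ≡-Reasoning
      |U|∸|b|≡p : length U ∸ length b ≡ p
      |U|∸|b|≡p = trans (cong (_∸ length b) (sym p+|b|≡|U|)) (m+n∸n≡m p (length b))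
      i<|b| : i < length b
      i<|b| = +-cancelʳ-< p i (length b)
                (subst (i + p <_) (trans (sym p+|b|≡|U|) (+-comm p (length b))) i+p<|U|)

  PrefixPeriod⇒HasPeriod : ∀ {U : List A} {p} → 0 < p → p ≤ length U →
                           PrefixPeriod U (length U) p → HasPeriod U p
  PrefixPeriod⇒HasPeriod {U} {p} 0<p p≤|U| per =
    drop p U , (|b|<|U| , b-prefix , b-suffix) , p+|b|≡|U|
    where
      |b|≡|U|∸p : length (drop p U) ≡ length U ∸ p
      |b|≡|U|∸p = length-drop p U
      |b|<|U| : length (drop p U) < length U
      |b|<|U| = subst (_< length U) (sym |b|≡|U|∸p) (∸-monoʳ-< 0<p p≤|U|)
      p+|b|≡|U| : p + length (drop p U) ≡ length U
      p+|b|≡|U| = trans (cong (p +_) |b|≡|U|∸p) (m+[n∸m]≡n p≤|U|)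
      i+p<|U| : ∀ {i} → i < length (drop p U) → i + p < length U
      i+p<|U| i<|b| = subst (_ <_) (trans (+-comm _ p) p+|b|≡|U|) (+-monoˡ-< p i<|b|)
      b-prefix : drop p U ≡ take (length (drop p U)) U
      b-prefix = agree⇒≡ (sym (length-take-≤ U (<⇒≤ |b|<|U|))) λ i i<|b| → begin
        drop p U ! i                     ≡⟨ !-drop p U i ⟩
        U ! (p + i)                      ≡⟨ cong (U !_) (+-comm p i) ⟩
        U ! (i + p)                      ≡⟨ sym (per i (i+p<|U| i<|b|)) ⟩
        U ! i                            ≡⟨ sym (take-agree _ U i i<|b|) ⟩
        take (length (drop p U)) U ! i   ∎
        where open ≡-Reasoning
      b-suffix : drop p U ≡ drop (length U ∸ length (drop p U)) U
      b-suffix = cong (λ k → drop k U)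
                   (sym (trans (cong (length U ∸_) |b|≡|U|∸p) (m∸[m∸n]≡n p≤|U|)))

  HasPeriod-take⇒PrefixPeriod : ∀ {T : List A} {n p} → n ≤ length T →
                                HasPeriod (take n T) p → PrefixPeriod T n p
  HasPeriod-take⇒PrefixPeriod {T} {n} {p} n≤|T| per =
    PrefixPeriod-agree (take-agree n T)
      (subst (λ k → PrefixPeriod (take n T) k p) (length-take-≤ T n≤|T|) (HasPeriod⇒PrefixPeriod per))

  PrefixPeriod⇒HasPeriod-take : ∀ {T : List A} {n p} → 0 < p → p ≤ n → n ≤ length T →
                                PrefixPeriod T n p → HasPeriod (take n T) p
  PrefixPeriod⇒HasPeriod-take {T} {n} {p} 0<p p≤n n≤|T| per =
    PrefixPeriod⇒HasPeriod 0<p (subst (p ≤_) (sym |take|≡n) p≤n)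
      (subst (λ k → PrefixPeriod (take n T) k p) (sym |take|≡n)
        (PrefixPeriod-agree (agree-sym (take-agree n T)) per))
    where
      |take|≡n = length-take-≤ T n≤|T|

  PrefixPeriod-difference : ∀ {S : List A} {n q d} → q + (q + d) ≤ n →
    PrefixPeriod S n q → PrefixPeriod S n (q + d) → PrefixPeriod S n d
  PrefixPeriod-difference {S} {n} {q} {d} 2q+d≤n per-q per-q+d i i+d<n with i + (q + d) <? n
  ... | yes i+q+d<n = begin
    S ! i              ≡⟨ per-q+d i i+q+d<n ⟩
    S ! (i + (q + d))  ≡⟨ cong (S !_) i+[q+d]≡i+d+q ⟩
    S ! (i + d + q)    ≡⟨ sym (per-q (i + d) (subst (_< n) i+[q+d]≡i+d+q i+q+d<n)) ⟩
    S ! (i + d)        ∎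
    where
      open ≡-Reasoning
      i+[q+d]≡i+d+q : i + (q + d) ≡ i + d + q
      i+[q+d]≡i+d+q = trans (cong (i +_) (+-comm q d)) (sym (+-assoc i d q))
  ... | no i+q+d≮n = begin
    S ! i                  ≡⟨ cong (S !_) (sym [i∸q]+q≡i) ⟩
    S ! (i ∸ q + q)        ≡⟨ sym (per-q (i ∸ q) (subst (_< n) (sym [i∸q]+q≡i) i<n)) ⟩
    S ! (i ∸ q)            ≡⟨ per-q+d (i ∸ q) (subst (_< n) (sym [i∸q]+[q+d]≡i+d) i+d<n) ⟩
    S ! (i ∸ q + (q + d))  ≡⟨ cong (S !_) [i∸q]+[q+d]≡i+d ⟩
    S ! (i + d)            ∎
    where
      open ≡-Reasoning
      q≤i : q ≤ i
      q≤i = +-cancelʳ-≤ (q + d) q i (≤-trans 2q+d≤n (≮⇒≥ i+q+d≮n))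
      [i∸q]+q≡i : i ∸ q + q ≡ i
      [i∸q]+q≡i = m∸n+n≡m q≤i
      i<n : i < n
      i<n = ≤-<-trans (m≤m+n i d) i+d<n
      [i∸q]+[q+d]≡i+d : i ∸ q + (q + d) ≡ i + d
      [i∸q]+[q+d]≡i+d = trans (sym (+-assoc (i ∸ q) q d)) (cong (_+ d) [i∸q]+q≡i)

  PrefixPeriod-extend : ∀ {S : List A} {c p r} → PrefixPeriod S (c + p) p →
    AgreeBelow r (drop c S) (drop (c + p) S) → PrefixPeriod S (c + p + r) p
  PrefixPeriod-extend {S} {c} {p} {r} per continues i i+p<c+p+r with i + p <? c + p
  ... | yes i+p<c+p = per i i+p<c+p
  ... | no i+p≮c+p = begin
    S ! i                ≡⟨ cong (S !_) (sym c+y≡i) ⟩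
    S ! (c + y)          ≡⟨ sym (!-drop c S y) ⟩
    drop c S ! y         ≡⟨ continues y y<r ⟩
    drop (c + p) S ! y   ≡⟨ !-drop (c + p) S y ⟩
    S ! (c + p + y)      ≡⟨ cong (S !_) c+p+y≡i+p ⟩
    S ! (i + p)          ∎
    where
      open ≡-Reasoning
      y = i ∸ c
      c+y≡i : c + y ≡ i
      c+y≡i = m+[n∸m]≡n (+-cancelʳ-≤ p c i (≮⇒≥ i+p≮c+p))
      c+p+y≡i+p : c + p + y ≡ i + p
      c+p+y≡i+p = trans (xy∙z≈xz∙y c p y) (cong (_+ p) c+y≡i)
      y<r : y < r
      y<r = +-cancelˡ-< (c + p) y r (subst (_< c + p + r) (sym c+p+y≡i+p) i+p<c+p+r)

  MaximalPrefixPeriod : List A → ℕ → ℕ → Set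
  MaximalPrefixPeriod T n p = n ≤ length T × PrefixPeriod T n p × (∀ m → PrefixPeriod T m p → m ≤ n)

  mismatch⇒MaximalPrefixPeriod : ∀ {S T : List A} {i p} → i + p < length S → length S ≤ length T →
    AgreeBelow (length S) S T → PrefixPeriod S (i + p) p → S ! i ≢ S ! (i + p) →
    MaximalPrefixPeriod T (i + p) p
  mismatch⇒MaximalPrefixPeriod {S} {T} {i} {p} i+p<|S| |S|≤|T| S≈T per mismatch =
    ≤-trans (<⇒≤ i+p<|S|) |S|≤|T| , PrefixPeriod-agree (agree-≤ (<⇒≤ i+p<|S|) S≈T) per , bounded
    where
      bounded : ∀ m → PrefixPeriod T m p → m ≤ i + p
      bounded m per-m = ≮⇒≥ λ i+p<m → mismatch (begin
        S ! i        ≡⟨ S≈T i (≤-<-trans (m≤m+n i p) i+p<|S|) ⟩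
        T ! i        ≡⟨ per-m i i+p<m ⟩
        T ! (i + p)  ≡⟨ sym (S≈T (i + p) i+p<|S|) ⟩
        S ! (i + p)  ∎)
        where open ≡-Reasoning

  LongestPrefixWithPeriod-unique : ∀ {T : List A} {p n k} → LongestPrefixWithPeriod T p n →
                                   MaximalPrefixPeriod T k p → n ≡ k
  LongestPrefixWithPeriod-unique {p = p} {n = n} {k = k} (n≤|T| , n-per , n-longest) (k≤|T| , k-per , k-maximal) =
    ≤-antisym (k-maximal n (HasPeriod-take⇒PrefixPeriod n≤|T| n-per))
              (n-longest k k≤|T| (PrefixPeriod⇒HasPeriod-take 0<p p≤k k≤|T| k-per))
    where
      0<p : 0 < p
      0<p = HasPeriod⇒0<p n-per
      p≤k : p ≤ k
      p≤k = k-maximal p λ i i+p<p → contradiction i+p<p (m+n≮n i p)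

  per-prefix-not-period : ∀ (b R : List A) {p q} → IsPer b p → 2 * p ≤ length b →
    IsPer (b ++ R) q → p ≢ q → ¬ PrefixPeriod (b ++ R) (length (b ++ R)) p
  per-prefix-not-period b R {p} {q} (p-per , p-min) 2p≤|b| (q-per , q-min) p≢q p-period =
    <-irrefl refl (<-≤-trans d<p (p-min d (PrefixPeriod⇒HasPeriod 0<d d≤|b| d-period-b)))
    where
      S = b ++ R
      p≤|b| = HasPeriod⇒≤length p-per
      |b|≤|S| = length-++-≤ˡ b
      q<p : q < p
      q<p = ≤∧≢⇒< (q-min p (PrefixPeriod⇒HasPeriod (HasPeriod⇒0<p p-per) (≤-trans p≤|b| |b|≤|S|)
                                                  p-period))
                  (p≢q ∘ sym)
      d = p ∸ q
      q+d≡p : q + d ≡ p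
      q+d≡p = m+[n∸m]≡n (<⇒≤ q<p)
      0<d : 0 < d
      0<d = m<n⇒0<n∸m q<p
      d<p : d < p
      d<p = subst (d <_) q+d≡p (m<n+m d (HasPeriod⇒0<p q-per))
      d≤|b| : d ≤ length b
      d≤|b| = ≤-trans (m∸n≤m p q) p≤|b|
      2q+d≤|S| : q + (q + d) ≤ length S
      2q+d≤|S| = begin
        q + (q + d)  ≡⟨ cong (q +_) q+d≡p ⟩
        q + p        ≤⟨ +-monoˡ-≤ p (<⇒≤ q<p) ⟩
        p + p        ≡⟨ cong (p +_) (sym (+-identityʳ p)) ⟩
        2 * p        ≤⟨ 2p≤|b| ⟩
        length b     ≤⟨ |b|≤|S| ⟩
        length S     ∎
        where open ≤-Reasoning
      d-period-S : PrefixPeriod S (length S) d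
      d-period-S = PrefixPeriod-difference 2q+d≤|S| (HasPeriod⇒PrefixPeriod q-per)
                     (subst (PrefixPeriod S (length S)) (sym q+d≡p) p-period)
      d-period-b : PrefixPeriod b (length b) d
      d-period-b = PrefixPeriod-agree (++-agree b R) (PrefixPeriod-≤ |b|≤|S| d-period-S)

  LCP⇒MaximalPrefixPeriod : ∀ {S T : List A} {c p r} → length S ≤ length T → AgreeBelow (length S) S T →
    PrefixPeriod S (c + p) p → LCP (drop c S) (drop (c + p) S) r → r < length (drop (c + p) S) →
    MaximalPrefixPeriod T (c + p + r) p
  LCP⇒MaximalPrefixPeriod {S} {T} {c} {p} {r} |S|≤|T| S≈T per lcp r<|drop| =
    subst (λ k → MaximalPrefixPeriod T k p) (xy∙z≈xz∙y c r p)
      (mismatch⇒MaximalPrefixPeriod c+r+p<|S| |S|≤|T| S≈T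
        (subst (λ k → PrefixPeriod S k p) (xy∙z≈xz∙y c p r) (PrefixPeriod-extend per (LCP-agree lcp)))
        mismatch)
    where
      r<|S|∸[c+p] : r < length S ∸ (c + p)
      r<|S|∸[c+p] = subst (r <_) (length-drop (c + p) S) r<|drop|
      c+p+r<|S| : c + p + r < length S
      c+p+r<|S| = subst (c + p + r <_) (m+[n∸m]≡n (<⇒≤ c+p<|S|)) (+-monoʳ-< (c + p) r<|S|∸[c+p])
        where
          c+p<|S| : c + p < length S
          c+p<|S| = m∸n≢0⇒n<m (m<n⇒n≢0 r<|S|∸[c+p])
      c+r+p<|S| : c + r + p < length S
      c+r+p<|S| = subst (_< length S) (xy∙z≈xz∙y c p r) c+p+r<|S|
      mismatch : S ! (c + r) ≢ S ! (c + r + p)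
      mismatch eq = LCP-mismatch lcp r<|drop| (begin
        drop c S ! r        ≡⟨ !-drop c S r ⟩
        S ! (c + r)         ≡⟨ eq ⟩
        S ! (c + r + p)     ≡⟨ cong (S !_) (xy∙z≈xz∙y c r p) ⟩
        S ! (c + p + r)     ≡⟨ sym (!-drop (c + p) S r) ⟩
        drop (c + p) S ! r  ∎)
        where open ≡-Reasoning

  per-prefix-run : ∀ (b R T : List A) {p q r} →
    length (b ++ R) ≤ length T → AgreeBelow (length (b ++ R)) (b ++ R) T →
    IsPer b p → 2 * p ≤ length b → IsPer (b ++ R) q → p ≢ q →
    LCP (drop (length b ∸ p) (b ++ R)) (drop (length b) (b ++ R)) r →
    MaximalPrefixPeriod T (length b + r) p
  per-prefix-run b R T {p} {q} {r} |S|≤|T| S≈T p-IsPer 2p≤|b| q-IsPer p≢q lcp =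
    subst (λ k → MaximalPrefixPeriod T (k + r) p) c+p≡|b|
      (LCP⇒MaximalPrefixPeriod |S|≤|T| S≈T p-period lcp′ r<|drop|)
    where
      S = b ++ R
      c = length b ∸ p
      c+p≡|b| : c + p ≡ length b
      c+p≡|b| = m∸n+n≡m (HasPeriod⇒≤length (proj₁ p-IsPer))
      lcp′ : LCP (drop c S) (drop (c + p) S) r
      lcp′ = subst (λ k → LCP (drop c S) (drop k S) r) (sym c+p≡|b|) lcp
      p-period : PrefixPeriod S (c + p) p
      p-period = subst (λ k → PrefixPeriod S k p) (sym c+p≡|b|)
                   (PrefixPeriod-agree (agree-sym (++-agree b R)) (HasPeriod⇒PrefixPeriod (proj₁ p-IsPer)))
      c+p+|drop|≡|S| : c + p + length (drop (c + p) S) ≡ length S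
      c+p+|drop|≡|S| = trans (cong (c + p +_) (length-drop (c + p) S))
                         (m+[n∸m]≡n (subst (_≤ length S) (sym c+p≡|b|) (length-++-≤ˡ b)))
      r<|drop| : r < length (drop (c + p) S)
      r<|drop| = ≤∧≢⇒< (LCP-≤-length lcp′) λ r≡|drop| →
        per-prefix-not-period b R p-IsPer 2p≤|b| q-IsPer p≢q
          (subst (λ k → PrefixPeriod S k p) (trans (cong (c + p +_) r≡|drop|) c+p+|drop|≡|S|)
            (PrefixPeriod-extend p-period (LCP-agree lcp′)))

  LCE-in-suffix : ∀ (T b R : List A) {p r} → p ≤ length b → length (b ++ R) ≤ length T →
    b ++ R ≡ drop (length T ∸ length (b ++ R)) T →
    LCE T (length T ∸ length R ∸ p + 1) (length T ∸ length R + 1) r →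
    LCP (drop (length b ∸ p) (b ++ R)) (drop (length b) (b ++ R)) r
  LCE-in-suffix T b R {p} {r} p≤|b| |S|≤|T| suffix =
    subst₂ (λ xs ys → LCP xs ys r)
      (drop-in-suffix (length b ∸ p) (trans (cong (_∸ p) |T|∸|R|≡a+|b|) (+-∸-assoc a p≤|b|)))
      (drop-in-suffix (length b) |T|∸|R|≡a+|b|)
    where
      open ≡-Reasoning
      a = length T ∸ length (b ++ R)
      |T|∸|R|≡a+|b| : length T ∸ length R ≡ a + length b
      |T|∸|R|≡a+|b| = begin
        length T ∸ length R                        ≡⟨ cong (_∸ length R) (sym (m∸n+n≡m |S|≤|T|)) ⟩
        a + length (b ++ R) ∸ length R             ≡⟨ cong (λ k → a + k ∸ length R) (length-++ b) ⟩
        a + (length b + length R) ∸ length R       ≡⟨ cong (_∸ length R) (sym (+-assoc a (length b) (length R))) ⟩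
        a + length b + length R ∸ length R         ≡⟨ m+n∸n≡m (a + length b) (length R) ⟩
        a + length b                               ∎
      drop-in-suffix : ∀ k {x} → x ≡ a + k → drop (x + 1 ∸ 1) T ≡ drop k (b ++ R)
      drop-in-suffix k {x} x≡a+k = begin
        drop (x + 1 ∸ 1) T  ≡⟨ cong (λ y → drop y T) (trans (m+n∸n≡m x 1) x≡a+k) ⟩
        drop (a + k) T      ≡⟨ sym (drop-drop a k T) ⟩
        drop k (drop a T)   ≡⟨ cong (drop k) (sym suffix) ⟩
        drop k (b ++ R)     ∎

lemma10 : {A : Set} (T w : List A) (i j : ℕ) →
    1 ≤ j → j ≤ length T → 1 ≤ i → i ≤ suc j →
    length (drop j T) ≤ length (take (i ∸ 1) T) →
    2 * length w ≤ length (take (i ∸ 1) T) →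
    Σ (List A) (λ c → LongestBorder c (take (i ∸ 1) T ++ w) × length w < length c) →
    Σ (List A) (λ c → Border c (take (i ∸ 1) T ++ w ++ drop j T) × length (drop j T) < length c) →
    (bs : List A) →
    Border bs (take (i ∸ 1) T ++ w) →
    LongestBorder (bs ++ drop j T) (take (i ∸ 1) T ++ w ++ drop j T) →
    (p : ℕ) → IsPer bs p →
    2 * p ≤ length bs →
    (q : ℕ) → IsPer (bs ++ drop j T) q → ¬ (p ≡ q) →
    (n : ℕ) → LongestPrefixWithPeriod (take (i ∸ 1) T ++ w ++ drop j T) p n →
    (r : ℕ) →
    LCE (take (i ∸ 1) T ++ w ++ drop j T)
        (length (take (i ∸ 1) T ++ w ++ drop j T) ∸ length (drop j T) ∸ p + 1)
        (length (take (i ∸ 1) T ++ w ++ drop j T) ∸ length (drop j T) + 1) r →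
    length bs + r ≡ n
lemma10 T w i j _ _ _ _ _ _ _ _ bs _ ((|S|<|T′| , S-prefix , S-suffix) , _)
        p p-IsPer 2p≤|bs| q q-IsPer p≢q n n-longest r lce =
  sym (LongestPrefixWithPeriod-unique n-longest
        (per-prefix-run bs R T′ |S|≤|T′| S≈T′ p-IsPer 2p≤|bs| q-IsPer p≢q
          (LCE-in-suffix T′ bs R (HasPeriod⇒≤length (proj₁ p-IsPer)) |S|≤|T′| S-suffix lce)))
  where
    R = drop j T
    T′ = take (i ∸ 1) T ++ w ++ R
    |S|≤|T′| : length (bs ++ R) ≤ length T′
    |S|≤|T′| = <⇒≤ |S|<|T′|
    S≈T′ : AgreeBelow (length (bs ++ R)) (bs ++ R) T′
    S≈T′ = subst (λ S → AgreeBelow (length (bs ++ R)) S T′) (sym S-prefix) (take-agree _ T′)
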